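{- Let $R$ be a region with $n$ cells, $n$ a multiple of $3$, let $P\subseteq R$ be a set of $n/3$ peg cells, and let $G$ be the region network of $(R,P)$. Then the reduction $(R,P)\mapsto (G, n/3)$ is parsimonious: the number of p-covers of $(R,P)$ equals the number of flows $f$ in $G$ with $|f| = n/3$.
   Context: A cell is a unit square $[x,x+1]\times[y,y+1]$, $x,y\in\mathbb Z$; it lies in row $y$. A region is a finite union of cells with connected interior; two cells are adjacent if their Manhattan distance is $1$. A tromino is an L-shaped set of three cells: a corner cell plus two tips adjacent to it, one horizontally and one vertically. A p-cover of $(R,P)$ is a set of pairwise non-overlapping trominoes contained in $R$ covering all cells of $R$, each with its corner cell in $P$ and its tips outside $P$. Region network: color a cell black if its row is even and white if odd; let $B$ be the black cells not in $P$ and $W$ the white cells not in $P$. $G$ has a vertex for each cell of $R$ plus a source $s$ and sink $t$; directed edges $s\to b$ for each $b\in B$; $w\to t$ for each $w\in W$; $b\to p$ for $b\in B$, $p\in P$ adjacent in $R$; $p\to w$ for $p\in P$, $w\in W$ adjacent in $R$. All edges have capacity $1$; every cell vertex has vertex capacity $1$, and $s,t$ have infinite capacity. A flow is a function $f:E(G)\to\mathbb N$ respecting edge capacities, with total flow entering each vertex at most its vertex capacity, and with flow conservation at every vertex other than $s,t$; its value is $|f|=\sum_v f(s,v)$. -}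

module Defs where

open import Data.Nat using (ℕ; zero; suc; _+_; _≤_)
open import Data.Integer as ℤ using (ℤ; +_; -[1+_]; ∣_∣)
open import Data.Integer.Divisibility using () renaming (_∣_ to _∣ℤ_)
open import Data.Fin using (Fin; zero; suc)
open import Data.Bool using (Bool; true)
open import Data.Product using (_×_; _,_; Σ; proj₁; proj₂; ∃₂)
open import Data.Sum using (_⊎_)
open import Data.List using (List; []; _∷_; length; lookup)
open import Data.List.Membership.Propositional using (_∈_; _∉_)
open import Data.List.Relation.Unary.All using (All)
open import Data.Vec using (Vec; tabulate; sum)
import Data.Vec as V
open import Relation.Nullary using (¬_)
open import Relation.Binary.PropositionalEquality using (_≡_)
open import Relation.Binary.Construct.Closure.ReflexiveTransitive using (Star)

-- A cell [x,x+1]×[y,y+1] is represented by its lower-left corner (x , y);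
-- it lies in row y.
Cell : Set
Cell = ℤ × ℤ

row : Cell → ℤ
row = proj₂

Adjacent : Cell → Cell → Set
Adjacent (x , y) (x′ , y′) = ∣ x ℤ.- x′ ∣ + ∣ y ℤ.- y′ ∣ ≡ 1

AdjIn : List Cell → Cell → Cell → Set
AdjIn R a b = a ∈ R × b ∈ R × Adjacent a b

-- The union of the cells of R has connected interior, i.e. any two cells
-- of R are joined by a path of edge-adjacent cells of R.
Connected : List Cell → Set
Connected R = ∀ {a b} → a ∈ R → b ∈ R → Star (AdjIn R) a b

-- The four orientations of an L-tromino: the signs (dx , dy) of the
-- horizontal and vertical tip relative to the corner cell.
dir : Fin 4 → ℤ × ℤ
dir zero                   = (+ 1 , + 1)
dir (suc zero)             = (+ 1 , -[1+ 0 ])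
dir (suc (suc zero))       = (-[1+ 0 ] , + 1)
dir (suc (suc (suc zero))) = (-[1+ 0 ] , -[1+ 0 ])

tipH : Cell → Fin 4 → Cell
tipH (x , y) o = (x ℤ.+ proj₁ (dir o) , y)

tipV : Cell → Fin 4 → Cell
tipV (x , y) o = (x , y ℤ.+ proj₂ (dir o))

trominoCells : Cell → Fin 4 → List Cell
trominoCells c o = c ∷ tipH c o ∷ tipV c o ∷ []

-- Every tromino contained in R has its corner cell in R, and a tromino is
-- determined by (corner, orientation).  Hence a finite set of trominoes
-- contained in R is encoded faithfully (and uniquely) by a table
-- S : Vec (Vec Bool 4) n (n = length R): the tromino with corner
-- `lookup R i` and orientation o belongs to the set iff S[i][o] = true.

TrominoSet : List Cell → Set
TrominoSet R = Vec (Vec Bool 4) (length R)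

cellAt : (R : List Cell) → Fin (length R) → Cell
cellAt R i = lookup R i

Selected : (R : List Cell) → TrominoSet R → Fin (length R) → Fin 4 → Set
Selected R S i o = V.lookup (V.lookup S i) o ≡ true

cellsOf : (R : List Cell) → Fin (length R) → Fin 4 → List Cell
cellsOf R i o = trominoCells (cellAt R i) o

record IsPCover (R P : List Cell) (S : TrominoSet R) : Set where
  field
    contained   : ∀ i o → Selected R S i o → All (_∈ R) (cellsOf R i o)
    cornerInP   : ∀ i o → Selected R S i o → cellAt R i ∈ P
    tipHNotInP  : ∀ i o → Selected R S i o → tipH (cellAt R i) o ∉ P
    tipVNotInP  : ∀ i o → Selected R S i o → tipV (cellAt R i) o ∉ P
    disjoint    : ∀ i o j o′ c → Selected R S i o → Selected R S j o′ →
                  c ∈ cellsOf R i o → c ∈ cellsOf R j o′ → (i ≡ j × o ≡ o′)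
    covers      : ∀ c → c ∈ R → ∃₂ λ i o → Selected R S i o × c ∈ cellsOf R i o

Black : Cell → Set
Black c = (+ 2) ∣ℤ row c

InB : (R P : List Cell) → Fin (length R) → Set
InB R P i = cellAt R i ∉ P × Black (cellAt R i)

InW : (R P : List Cell) → Fin (length R) → Set
InW R P i = cellAt R i ∉ P × ¬ Black (cellAt R i)

InP : (R P : List Cell) → Fin (length R) → Set
InP R P i = cellAt R i ∈ P

MidEdge : (R P : List Cell) → Fin (length R) → Fin (length R) → Set
MidEdge R P i j =
  (InB R P i × InP R P j × Adjacent (cellAt R i) (cellAt R j)) ⊎
  (InP R P i × InW R P j × Adjacent (cellAt R i) (cellAt R j))

-- A function E(G) → ℕ is encoded by its values on all potential edges
-- s → i, i → t, i → j, required to vanish on pairs which are not edges of G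
-- (this is a bijective encoding of functions E(G) → ℕ).
record FlowData (n : ℕ) : Set where
  constructor flowData
  field
    src : Vec ℕ n
    snk : Vec ℕ n
    mid : Vec (Vec ℕ n) n       -- f(i → j) = mid[i][j]
open FlowData public

inflow : ∀ {n} → FlowData n → Fin n → ℕ
inflow f i = V.lookup (src f) i + sum (tabulate λ j → V.lookup (V.lookup (mid f) j) i)

outflow : ∀ {n} → FlowData n → Fin n → ℕ
outflow f i = V.lookup (snk f) i + sum (tabulate λ j → V.lookup (V.lookup (mid f) i) j)

value : ∀ {n} → FlowData n → ℕ
value f = sum (src f)

record IsFlow (R P : List Cell) (f : FlowData (length R)) : Set where
  field
    srcSupport : ∀ i → ¬ InB R P i → V.lookup (src f) i ≡ 0
    snkSupport : ∀ i → ¬ InW R P i → V.lookup (snk f) i ≡ 0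
    midSupport : ∀ i j → ¬ MidEdge R P i j → V.lookup (V.lookup (mid f) i) j ≡ 0
    srcCap     : ∀ i → V.lookup (src f) i ≤ 1
    snkCap     : ∀ i → V.lookup (snk f) i ≤ 1
    midCap     : ∀ i j → V.lookup (V.lookup (mid f) i) j ≤ 1
    vertexCap  : ∀ i → inflow f i ≤ 1
    conserve   : ∀ i → inflow f i ≡ outflow f i

-- Equinumerosity of two (finite) subsets, given as predicates on types
-- with propositional equality: an explicit bijection between
-- {a | A a} and {b | B b}.

record Bijection {X Y : Set} (A : X → Set) (B : Y → Set) : Set where
  field
    to      : X → Y
    from    : Y → X
    to-ok   : ∀ x → A x → B (to x)
    from-ok : ∀ y → B y → A (from y)
    from-to : ∀ x → A x → from (to x) ≡ x
    to-from : ∀ y → B y → to (from y) ≡ y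

module Submission where

open import Defs
open import Data.Nat using (ℕ; _*_)
open import Data.Product using (_×_)
open import Data.List using (List; length)
open import Data.List.Membership.Propositional using (_∈_)
open import Data.List.Relation.Unary.All using (All)
open import Data.List.Relation.Unary.Unique.Propositional using (Unique)
open import Relation.Binary.PropositionalEquality using (_≡_)

-- A flow of value n/3 is determined by its values on the edges between cell vertices: conservation forces
-- f(s → b) = outflow of b and f(w → t) = inflow of w.  Every such edge runs black → peg or peg → white, so by
-- double counting the flow through the pegs equals the value; value |P| with vertex capacity 1 saturates every
-- peg, and since the black and white cells number 2|P| in total, every non-peg cell is saturated as well.  The
-- flow thus consists of vertex-disjoint paths b → p → w covering all of R.  The neighbours b and w of p have
-- different colours, i.e. one lies in p's row and the other does not, so they are the two tips of an L-tromino
-- with corner p; conversely each tromino of a p-cover yields the path from its black tip through its corner to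
-- its white tip.

module FiniteSums where

  open import Data.Nat using (ℕ; zero; suc; _+_; _*_; _≤_; z≤n)
  open import Data.Nat.Properties
  open import Data.Fin using (Fin; zero; suc)
  import Data.Fin.Properties as Fin
  open import Data.Product using (_×_; ∃; _,_; proj₁; proj₂)
  open import Data.Sum using (inj₁; inj₂)
  open import Data.Empty using (⊥-elim)
  open import Data.Vec using (Vec; tabulate; lookup)
  import Data.Vec as Vec
  open import Data.Vec.Properties using (tabulate∘lookup; lookup∘tabulate; tabulate-cong)
  open import Data.Vec.Functional using (Vector)
  open import Function using (_∘_)
  open import Relation.Nullary using (¬?; yes; no)
  open import Relation.Nullary.Decidable using (decidable-stable)
  open import Relation.Binary.PropositionalEquality
  open import Algebra.Properties.Semiring.Sum +-*-semiring public
    using (sum; sum-syntax; sum-cong-≗; ∑-distrib-+; ∑-comm; *-distribˡ-sum)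

  Vec-ext : ∀ {A : Set} {n} {xs ys : Vec A n} → (∀ i → lookup xs i ≡ lookup ys i) → xs ≡ ys
  Vec-ext {xs = xs} {ys} eq = trans (sym (tabulate∘lookup xs)) (trans (tabulate-cong eq) (tabulate∘lookup ys))

  lookup²∘tabulate² : ∀ {A : Set} {m n} (f : Fin m → Fin n → A) i j →
                      lookup (lookup (tabulate λ i → tabulate (f i)) i) j ≡ f i j
  lookup²∘tabulate² f i j =
    trans (cong (λ row → lookup row j) (lookup∘tabulate (λ i → tabulate (f i)) i)) (lookup∘tabulate (f i) j)

  sum-tabulate : ∀ {n} (f : Vector ℕ n) → Vec.sum (tabulate f) ≡ sum f
  sum-tabulate {zero}  f = refl
  sum-tabulate {suc n} f = cong (f zero +_) (sum-tabulate (f ∘ suc))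

  sum-lookup : ∀ {n} (xs : Vec ℕ n) → Vec.sum xs ≡ sum (lookup xs)
  sum-lookup xs = trans (cong Vec.sum (sym (tabulate∘lookup xs))) (sum-tabulate (lookup xs))

  ∑-zero : ∀ {n} {f : Vector ℕ n} → (∀ i → f i ≡ 0) → sum f ≡ 0
  ∑-zero {zero}  eq = refl
  ∑-zero {suc n} eq = cong₂ _+_ (eq zero) (∑-zero (eq ∘ suc))

  ∑-const-1 : ∀ n → ∑[ i < n ] 1 ≡ n
  ∑-const-1 zero    = refl
  ∑-const-1 (suc n) = cong suc (∑-const-1 n)

  ≤-∑ : ∀ {n} (f : Vector ℕ n) i → f i ≤ sum f
  ≤-∑ f zero    = m≤m+n _ _
  ≤-∑ f (suc i) = ≤-trans (≤-∑ (f ∘ suc) i) (m≤n+m _ (f zero))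

  ∑-mono-≤ : ∀ {n} {f g : Vector ℕ n} → (∀ i → f i ≤ g i) → sum f ≤ sum g
  ∑-mono-≤ {zero}  le = z≤n
  ∑-mono-≤ {suc n} le = +-mono-≤ (le zero) (∑-mono-≤ (le ∘ suc))

  +-mono-≤-≡⇒≡ : ∀ {a b c d} → a ≤ b → c ≤ d → a + c ≡ b + d → a ≡ b × c ≡ d
  +-mono-≤-≡⇒≡ {a} {b} {c} {d} a≤b c≤d eq with m≤n⇒m<n∨m≡n a≤b
  ... | inj₁ a<b  = ⊥-elim (<⇒≢ (+-mono-<-≤ a<b c≤d) eq)
  ... | inj₂ refl = refl , +-cancelˡ-≡ a c d eq

  ∑-mono-≤-≡⇒≡ : ∀ {n} {f g : Vector ℕ n} → (∀ i → f i ≤ g i) → sum f ≡ sum g →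
                 ∀ i → f i ≡ g i
  ∑-mono-≤-≡⇒≡ le eq zero    = proj₁ (+-mono-≤-≡⇒≡ (le zero) (∑-mono-≤ (le ∘ suc)) eq)
  ∑-mono-≤-≡⇒≡ le eq (suc i) =
    ∑-mono-≤-≡⇒≡ (le ∘ suc) (proj₂ (+-mono-≤-≡⇒≡ (le zero) (∑-mono-≤ (le ∘ suc)) eq)) i

  ∑-single : ∀ {n} {f : Vector ℕ n} k → (∀ i → i ≢ k → f i ≡ 0) → sum f ≡ f k
  ∑-single {f = f} zero    eq = trans (cong (f zero +_) (∑-zero (λ i → eq (suc i) λ ()))) (+-identityʳ _)
  ∑-single {f = f} (suc k) eq =
    cong₂ _+_ (eq zero λ ()) (∑-single k λ i i≢k → eq (suc i) (i≢k ∘ Fin.suc-injective))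

  ∑≢0⇒nonzero : ∀ {n} (f : Vector ℕ n) → sum f ≢ 0 → ∃ λ i → f i ≢ 0
  ∑≢0⇒nonzero f ∑f≢0 with Fin.any? (λ i → ¬? (f i ≟ 0))
  ... | yes nonzero = nonzero
  ... | no  allZero =
    ⊥-elim (∑f≢0 (∑-zero λ i → decidable-stable (f i ≟ 0) (λ fi≢0 → allZero (i , fi≢0))))

  ∑≤1⇒nonzero-unique : ∀ {n} (f : Vector ℕ n) → sum f ≤ 1 → ∀ i j → f i ≢ 0 → f j ≢ 0 → i ≡ j
  ∑≤1⇒nonzero-unique f ∑f≤1 zero    zero    _ _ = refl
  ∑≤1⇒nonzero-unique f ∑f≤1 zero    (suc j) f₀≢0 fj≢0 =
    ⊥-elim (<⇒≱ (+-mono-≤ (n≢0⇒n>0 f₀≢0) (≤-trans (n≢0⇒n>0 fj≢0) (≤-∑ (f ∘ suc) j))) ∑f≤1)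
  ∑≤1⇒nonzero-unique f ∑f≤1 (suc i) zero    fi≢0 f₀≢0 =
    ⊥-elim (<⇒≱ (+-mono-≤ (n≢0⇒n>0 f₀≢0) (≤-trans (n≢0⇒n>0 fi≢0) (≤-∑ (f ∘ suc) i))) ∑f≤1)
  ∑≤1⇒nonzero-unique f ∑f≤1 (suc i) (suc j) fi≢0 fj≢0 =
    cong suc (∑≤1⇒nonzero-unique (f ∘ suc) (≤-trans (m≤n+m _ (f zero)) ∑f≤1) i j fi≢0 fj≢0)

  ≡1⇒≢0 : ∀ {x} → x ≡ 1 → x ≢ 0
  ≡1⇒≢0 refl ()

  ∑≤1∧term≡1⇒∑≡1 : ∀ {n} (f : Vector ℕ n) k → sum f ≤ 1 → f k ≡ 1 → sum f ≡ 1
  ∑≤1∧term≡1⇒∑≡1 f k ∑f≤1 fk≡1 = ≤-antisym ∑f≤1 (≤-trans (≤-reflexive (sym fk≡1)) (≤-∑ f k))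

  nonzero-unique⇒∑≤1 : ∀ {n} (f : Vector ℕ n) → (∀ i → f i ≤ 1) →
                        (∀ i j → f i ≢ 0 → f j ≢ 0 → i ≡ j) → sum f ≤ 1
  nonzero-unique⇒∑≤1 f f≤1 unique with sum f ≟ 0
  ... | yes ∑f≡0 = ≤-trans (≤-reflexive ∑f≡0) z≤n
  ... | no  ∑f≢0 with ∑≢0⇒nonzero f ∑f≢0
  ... | k , fk≢0 = ≤-trans (≤-reflexive (∑-single k others-zero)) (f≤1 k)
    where
    others-zero : ∀ i → i ≢ k → f i ≡ 0
    others-zero i i≢k = decidable-stable (f i ≟ 0) (λ fi≢0 → i≢k (unique i k fi≢0 fk≢0))

  double-count : ∀ {m n} (M : Fin m → Fin n → ℕ) (f : Vector ℕ m) (g : Vector ℕ n) →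
                 (∀ i j → M i j ≢ 0 → f i ≡ g j) →
                 ∑[ i < m ] (f i * ∑[ j < n ] M i j) ≡ ∑[ j < n ] (g j * ∑[ i < m ] M i j)
  double-count {m} {n} M f g f≡g = begin
    ∑[ i < m ] (f i * ∑[ j < n ] M i j)   ≡⟨ sum-cong-≗ (λ i → *-distribˡ-sum (f i) (M i)) ⟩
    ∑[ i < m ] ∑[ j < n ] (f i * M i j)   ≡⟨ sum-cong-≗ (λ i → sum-cong-≗ (λ j → along-edge i j)) ⟩
    ∑[ i < m ] ∑[ j < n ] (g j * M i j)   ≡⟨ ∑-comm (λ i j → g j * M i j) ⟩
    ∑[ j < n ] ∑[ i < m ] (g j * M i j)   ≡⟨ sum-cong-≗ (λ j → *-distribˡ-sum (g j) (λ i → M i j)) ⟨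
    ∑[ j < n ] (g j * ∑[ i < m ] M i j)   ∎
    where
    open ≡-Reasoning
    along-edge : ∀ i j → f i * M i j ≡ g j * M i j
    along-edge i j with M i j ≟ 0
    ... | yes Mij≡0 rewrite Mij≡0 = trans (*-zeroʳ (f i)) (sym (*-zeroʳ (g j)))
    ... | no  Mij≢0 = cong (_* M i j) (f≡g i j Mij≢0)

module Indicators where

  open FiniteSums
  open import Data.Nat using (ℕ; suc; _+_; _≤_; z≤n; s≤s)
  open import Data.Bool using (true; if_then_else_)
  open import Data.Fin using (Fin; zero; suc)
  open import Data.List using (List; []; _∷_; length; lookup)
  open import Data.List.Relation.Unary.All using (All; _∷_)
  import Data.List.Relation.Unary.All as All
  open import Data.List.Relation.Unary.All.Properties using (All¬⇒¬Any)
  open import Data.List.Relation.Unary.Any using (index)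
  open import Data.List.Relation.Unary.Any.Properties using (lookup-index)
  open import Data.List.Relation.Unary.Unique.Propositional using (Unique; _∷_)
  open import Data.List.Membership.Propositional using (_∈_; _∉_)
  open import Data.List.Membership.Propositional.Properties using (∈-lookup)
  open import Data.Empty using (⊥-elim)
  open import Relation.Nullary using (¬_; Dec; yes; no; does)
  open import Relation.Nullary.Decidable using (dec-true; dec-false)
  open import Relation.Binary using (DecidableEquality)
  open import Relation.Binary.PropositionalEquality

  𝟙 : ∀ {A : Set} → Dec A → ℕ
  𝟙 a? = if does a? then 1 else 0

  module _ {A : Set} (a? : Dec A) where

    𝟙-yes : A → 𝟙 a? ≡ 1
    𝟙-yes a = cong (if_then 1 else 0) (dec-true a? a)

    𝟙-no : ¬ A → 𝟙 a? ≡ 0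
    𝟙-no ¬a = cong (if_then 1 else 0) (dec-false a? ¬a)

  𝟙≤1 : ∀ {A : Set} (a? : Dec A) → 𝟙 a? ≤ 1
  𝟙≤1 (yes _) = s≤s z≤n
  𝟙≤1 (no  _) = z≤n

  𝟙≢0⇒ : ∀ {A : Set} (a? : Dec A) → 𝟙 a? ≢ 0 → A
  𝟙≢0⇒ (yes a) _   = a
  𝟙≢0⇒ (no  _) 𝟙≢0 = ⊥-elim (𝟙≢0 refl)

  does≡true⇒ : ∀ {A : Set} (a? : Dec A) → does a? ≡ true → A
  does≡true⇒ (yes a) _  = a
  does≡true⇒ (no _)  ()

  lookup-injective : ∀ {A : Set} {xs : List A} → Unique xs → ∀ i j → lookup xs i ≡ lookup xs j → i ≡ j
  lookup-injective (_ ∷ _)        zero    zero    _  = refl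
  lookup-injective (x∉xs ∷ _)     zero    (suc j) eq = ⊥-elim (All.lookup x∉xs (∈-lookup j) eq)
  lookup-injective (x∉xs ∷ _)     (suc i) zero    eq = ⊥-elim (All.lookup x∉xs (∈-lookup i) (sym eq))
  lookup-injective (_ ∷ unique)   (suc i) (suc j) eq = cong suc (lookup-injective unique i j eq)

  module _ {A : Set} (_≟_ : DecidableEquality A) where

    open import Data.List.Membership.DecPropositional _≟_ using (_∈?_)

    𝟙-∈-∷ : ∀ {x y} {ys : List A} → y ∉ ys → 𝟙 (x ∈? y ∷ ys) ≡ 𝟙 (x ≟ y) + 𝟙 (x ∈? ys)
    𝟙-∈-∷ {x} {y} {ys} y∉ys with x ≟ y
    ... | yes refl = cong suc (sym (𝟙-no (x ∈? ys) y∉ys))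
    ... | no  _    = refl

    count-≡ : ∀ {xs : List A} {y} → Unique xs → y ∈ xs → ∑[ i < length xs ] 𝟙 (lookup xs i ≟ y) ≡ 1
    count-≡ {xs} {y} unique y∈xs =
      trans (∑-single k others) (𝟙-yes (lookup xs k ≟ y) (sym (lookup-index y∈xs)))
      where
      k : Fin (length xs)
      k = index y∈xs
      others : ∀ i → i ≢ k → 𝟙 (lookup xs i ≟ y) ≡ 0
      others i i≢k = 𝟙-no (lookup xs i ≟ y) λ eq →
        i≢k (lookup-injective unique i k (trans eq (lookup-index y∈xs)))

    count-∈ : ∀ {xs : List A} ys → Unique xs → Unique ys → All (_∈ xs) ys →
              ∑[ i < length xs ] 𝟙 (lookup xs i ∈? ys) ≡ length ys
    count-∈ {xs} [] _ _ _ = ∑-zero {length xs} λ _ → refl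
    count-∈ {xs} (y ∷ ys) xs-unique (y∉ys ∷ ys-unique) (y∈xs ∷ ys⊆xs) = begin
      ∑[ i < length xs ] 𝟙 (lookup xs i ∈? y ∷ ys)
        ≡⟨ sum-cong-≗ (λ i → 𝟙-∈-∷ {lookup xs i} (All¬⇒¬Any y∉ys)) ⟩
      ∑[ i < length xs ] (𝟙 (lookup xs i ≟ y) + 𝟙 (lookup xs i ∈? ys))
        ≡⟨ ∑-distrib-+ (λ i → 𝟙 (lookup xs i ≟ y)) (λ i → 𝟙 (lookup xs i ∈? ys)) ⟩
      ∑[ i < length xs ] 𝟙 (lookup xs i ≟ y) + ∑[ i < length xs ] 𝟙 (lookup xs i ∈? ys)
        ≡⟨ cong₂ _+_ (count-≡ xs-unique y∈xs) (count-∈ ys xs-unique ys-unique ys⊆xs) ⟩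
      suc (length ys) ∎
      where open ≡-Reasoning

module TrominoGeometry where

  open import Data.Nat as ℕ using (suc; s≤s)
  import Data.Nat.Divisibility as ℕ
  open import Data.Integer using (ℤ; +_; -[1+_]; ∣_∣; _+_; _-_)
  open import Data.Integer.Properties using (∣i∣≡0⇒i≡0; ∣-i∣≡∣i∣; i-j≡0⇒i≡j; +-identityˡ; +-0-abelianGroup)
  open import Data.Integer.Divisibility using (_∣_)
  import Data.Integer.Divisibility.Signed as Signed
  open import Data.Integer.DivMod using (_/ℕ_; _%ℕ_; n%ℕd<d; a≡a%ℕn+[a/ℕn]*n)
  open import Data.Integer.Solver using (module +-*-Solver)
  open import Algebra.Properties.AbelianGroup +-0-abelianGroup using (∙-cancelˡ)
  open import Data.Fin using (Fin)
  open import Data.Fin.Patterns using (0F; 1F; 2F; 3F)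
  open import Data.Bool using (if_then_else_)
  open import Data.Product using (_,_; proj₁; proj₂; ∃; map₂; swap)
  open import Data.Sum using (_⊎_; inj₁; inj₂)
  import Data.Sum
  open import Data.Empty using (⊥-elim)
  open import Data.List.Relation.Unary.Any using (here; there)
  open import Relation.Nullary using (¬_; Dec; yes; no; does)
  open import Relation.Binary.PropositionalEquality
  open +-*-Solver

  -- Opaque, so that `with Black? c` can abstract it in goals mentioning blackTip and whiteTip.
  opaque
    Black? : ∀ c → Dec (Black c)
    Black? c = 2 ℕ.∣? ∣ row c ∣

  data IsSign : ℤ → Set where
    plus  : IsSign (+ 1)
    minus : IsSign -[1+ 0 ]

  ∣s∣≡1⇒IsSign : ∀ {s} → ∣ s ∣ ≡ 1 → IsSign s
  ∣s∣≡1⇒IsSign {+ .1}     refl = plus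
  ∣s∣≡1⇒IsSign { -[1+ 0 ]} refl = minus

  IsSign⇒∣s∣≡1 : ∀ {s} → IsSign s → ∣ s ∣ ≡ 1
  IsSign⇒∣s∣≡1 plus  = refl
  IsSign⇒∣s∣≡1 minus = refl

  even⇒odd-neighbour : ∀ y {s} → IsSign s → + 2 ∣ y → ¬ + 2 ∣ y + s
  even⇒odd-neighbour y {s} sign 2∣y 2∣y+s
    with ℕ.∣⇒≤ (subst (2 ℕ.∣_) (IsSign⇒∣s∣≡1 sign)
                  (Signed.∣⇒∣ᵤ (Signed.∣m+n∣m⇒∣n {+ 2} {y} {s} (Signed.∣ᵤ⇒∣ 2∣y+s) (Signed.∣ᵤ⇒∣ 2∣y))))
  ... | s≤s ()

  odd⇒even-neighbour : ∀ y {s} → IsSign s → ¬ + 2 ∣ y → + 2 ∣ y + s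
  odd⇒even-neighbour y sign ¬2∣y with y %ℕ 2 | n%ℕd<d y 2 | a≡a%ℕn+[a/ℕn]*n y 2
  ... | 0 | _ | y≡ = ⊥-elim (¬2∣y (Signed.∣⇒∣ᵤ (Signed.divides (y /ℕ 2) (trans y≡ (+-identityˡ _)))))
  ... | 1 | _ | y≡ = Signed.∣⇒∣ᵤ (neighbour sign)
    where
    q : ℤ
    q = y /ℕ 2
    neighbour : ∀ {s} → IsSign s → Signed._∣_ (+ 2) (y + s)
    neighbour plus  = Signed.divides (q + + 1) (trans (cong (_+ + 1) y≡)
      (solve 1 (λ q → con (+ 1) :+ q :* con (+ 2) :+ con (+ 1) := (q :+ con (+ 1)) :* con (+ 2)) refl q))
    neighbour minus = Signed.divides q (trans (cong (_+ -[1+ 0 ]) y≡)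
      (solve 1 (λ q → con (+ 1) :+ q :* con (+ 2) :+ con -[1+ 0 ] := q :* con (+ 2)) refl q))
  ... | suc (suc _) | s≤s (s≤s ()) | _

  dx dy : Fin 4 → ℤ
  dx o = proj₁ (dir o)
  dy o = proj₂ (dir o)

  dx-sign : ∀ o → IsSign (dx o)
  dx-sign 0F = plus
  dx-sign 1F = plus
  dx-sign 2F = minus
  dx-sign 3F = minus

  dy-sign : ∀ o → IsSign (dy o)
  dy-sign 0F = plus
  dy-sign 1F = minus
  dy-sign 2F = plus
  dy-sign 3F = minus

  fromDir : ℤ × ℤ → Fin 4
  fromDir (+ _      , + _)      = 0F
  fromDir (+ _      , -[1+ _ ]) = 1F
  fromDir (-[1+ _ ] , + _)      = 2F
  fromDir (-[1+ _ ] , -[1+ _ ]) = 3F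

  fromDir-dir : ∀ o → fromDir (dir o) ≡ o
  fromDir-dir 0F = refl
  fromDir-dir 1F = refl
  fromDir-dir 2F = refl
  fromDir-dir 3F = refl

  dir-fromDir : ∀ {s t} → IsSign s → IsSign t → dir (fromDir (s , t)) ≡ (s , t)
  dir-fromDir plus  plus  = refl
  dir-fromDir plus  minus = refl
  dir-fromDir minus plus  = refl
  dir-fromDir minus minus = refl

  tips-injective : ∀ c {o o′} → tipH c o ≡ tipH c o′ → tipV c o ≡ tipV c o′ → o ≡ o′
  tips-injective c {o} {o′} h v = begin
    o                  ≡⟨ fromDir-dir o ⟨
    fromDir (dir o)    ≡⟨ cong fromDir (cong₂ _,_ (∙-cancelˡ (proj₁ c) _ _ (cong proj₁ h))
                                                   (∙-cancelˡ (proj₂ c) _ _ (cong proj₂ v))) ⟩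
    fromDir (dir o′)   ≡⟨ fromDir-dir o′ ⟩
    o′                 ∎
    where open ≡-Reasoning

  Adjacent-sym : ∀ c d → Adjacent c d → Adjacent d c
  Adjacent-sym (x , y) (x′ , y′) = subst (_≡ 1) (cong₂ ℕ._+_ (∣-∣-comm x x′) (∣-∣-comm y y′))
    where
    ∣-∣-comm : ∀ a b → ∣ a - b ∣ ≡ ∣ b - a ∣
    ∣-∣-comm a b = trans (cong ∣_∣ (solve 2 (λ a b → a :- b := :- (b :- a)) refl a b)) (∣-i∣≡∣i∣ (b - a))

  a≡b+[a-b] : ∀ a b → a ≡ b + (a - b)
  a≡b+[a-b] = solve 2 (λ a b → a := b :+ (a :- b)) refl

  tipH-adjacent : ∀ c o → Adjacent c (tipH c o)
  tipH-adjacent (x , y) o =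
    cong₂ ℕ._+_ (trans (cong ∣_∣ (solve 2 (λ x d → x :- (x :+ d) := :- d) refl x (dx o)))
                       (trans (∣-i∣≡∣i∣ (dx o)) (IsSign⇒∣s∣≡1 (dx-sign o))))
                (cong ∣_∣ (solve 1 (λ y → y :- y := con (+ 0)) refl y))

  tipV-adjacent : ∀ c o → Adjacent c (tipV c o)
  tipV-adjacent (x , y) o =
    cong₂ ℕ._+_ (cong ∣_∣ (solve 1 (λ x → x :- x := con (+ 0)) refl x))
                (trans (cong ∣_∣ (solve 2 (λ y d → y :- (y :+ d) := :- d) refl y (dy o)))
                       (trans (∣-i∣≡∣i∣ (dy o)) (IsSign⇒∣s∣≡1 (dy-sign o))))

  adjacent⇒tip : ∀ d c → Adjacent d c → (∃ λ o → d ≡ tipH c o) ⊎ (∃ λ o → d ≡ tipV c o)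
  adjacent⇒tip (x′ , y′) (x , y) adj with ∣ x′ - x ∣ in ex | ∣ y′ - y ∣ in ey
  adjacent⇒tip (x′ , y′) (x , y) refl | 0 | 1 =
    inj₂ (fromDir (+ 1 , y′ - y) ,
          cong₂ _,_ (i-j≡0⇒i≡j x′ x (∣i∣≡0⇒i≡0 ex))
                    (trans (a≡b+[a-b] y′ y)
                           (cong (λ d → y + d) (sym (cong proj₂ (dir-fromDir plus (∣s∣≡1⇒IsSign ey)))))))
  adjacent⇒tip (x′ , y′) (x , y) refl | 1 | 0 =
    inj₁ (fromDir (x′ - x , + 1) ,
          cong₂ _,_ (trans (a≡b+[a-b] x′ x)
                           (cong (λ d → x + d) (sym (cong proj₁ (dir-fromDir (∣s∣≡1⇒IsSign ex) plus)))))
                    (i-j≡0⇒i≡j y′ y (∣i∣≡0⇒i≡0 ey)))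
  adjacent⇒tip (x′ , y′) (x , y) () | 0 | 0
  adjacent⇒tip (x′ , y′) (x , y) () | 0 | suc (suc _)
  adjacent⇒tip (x′ , y′) (x , y) () | 1 | suc _
  adjacent⇒tip (x′ , y′) (x , y) () | suc (suc _) | _

  corner-orientation : ∀ c oh ov → ∃ λ o → tipH c o ≡ tipH c oh × tipV c o ≡ tipV c ov
  corner-orientation c oh ov =
    fromDir (dx oh , dy ov) ,
    cong (λ d → (proj₁ c + proj₁ d , row c)) e ,
    cong (λ d → (proj₁ c , row c + proj₂ d)) e
    where
    e : dir (fromDir (dx oh , dy ov)) ≡ (dx oh , dy ov)
    e = dir-fromDir (dx-sign oh) (dy-sign ov)

  -- The horizontal tip lies in the row of the corner, the vertical tip in a row of the other colour.
  blackTip whiteTip : Cell → Fin 4 → Cell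
  blackTip c o = if does (Black? c) then tipH c o else tipV c o
  whiteTip c o = if does (Black? c) then tipV c o else tipH c o

  blackTip-black : ∀ c o → Black (blackTip c o)
  blackTip-black c o with Black? c
  ... | yes black = black
  ... | no  white = odd⇒even-neighbour (row c) (dy-sign o) white

  whiteTip-white : ∀ c o → ¬ Black (whiteTip c o)
  whiteTip-white c o with Black? c
  ... | yes black = even⇒odd-neighbour (row c) (dy-sign o) black
  ... | no  white = white

  blackTip-adjacent : ∀ c o → Adjacent (blackTip c o) c
  blackTip-adjacent c o with Black? c
  ... | yes _ = Adjacent-sym c (tipH c o) (tipH-adjacent c o)
  ... | no  _ = Adjacent-sym c (tipV c o) (tipV-adjacent c o)

  whiteTip-adjacent : ∀ c o → Adjacent c (whiteTip c o)
  whiteTip-adjacent c o with Black? c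
  ... | yes _ = tipV-adjacent c o
  ... | no  _ = tipH-adjacent c o

  tipH-coloured : ∀ c o → tipH c o ≡ blackTip c o ⊎ tipH c o ≡ whiteTip c o
  tipH-coloured c o with Black? c
  ... | yes _ = inj₁ refl
  ... | no  _ = inj₂ refl

  tipV-coloured : ∀ c o → tipV c o ≡ blackTip c o ⊎ tipV c o ≡ whiteTip c o
  tipV-coloured c o with Black? c
  ... | yes _ = inj₂ refl
  ... | no  _ = inj₁ refl

  blackTip-∈ : ∀ c o → blackTip c o ∈ trominoCells c o
  blackTip-∈ c o with Black? c
  ... | yes _ = there (here refl)
  ... | no  _ = there (there (here refl))

  whiteTip-∈ : ∀ c o → whiteTip c o ∈ trominoCells c o
  whiteTip-∈ c o with Black? c
  ... | yes _ = there (there (here refl))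
  ... | no  _ = there (here refl)

  ∈-trominoCells⁻ : ∀ {c o x} → x ∈ trominoCells c o → x ≡ c ⊎ x ≡ blackTip c o ⊎ x ≡ whiteTip c o
  ∈-trominoCells⁻             (here x≡c)                 = inj₁ x≡c
  ∈-trominoCells⁻ {c} {o} (there (here x≡h))         = inj₂ (Data.Sum.map (trans x≡h) (trans x≡h) (tipH-coloured c o))
  ∈-trominoCells⁻ {c} {o} (there (there (here x≡v))) = inj₂ (Data.Sum.map (trans x≡v) (trans x≡v) (tipV-coloured c o))

  coloured-tips-injective : ∀ c {o o′} → blackTip c o ≡ blackTip c o′ → whiteTip c o ≡ whiteTip c o′ →
                            o ≡ o′
  coloured-tips-injective c b w with Black? c
  ... | yes _ = tips-injective c b w
  ... | no  _ = tips-injective c w b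

  tromino-with-tips : ∀ {b c w} → Black b → ¬ Black w → Adjacent b c → Adjacent c w →
                      ∃ λ o → blackTip c o ≡ b × whiteTip c o ≡ w
  tromino-with-tips {b} {c} {w} black-b white-w b~c c~w
    with Black? c | adjacent⇒tip b c b~c | adjacent⇒tip w c (Adjacent-sym c w c~w)
  ... | yes _ | inj₁ (oh , refl) | inj₂ (ov , refl) = corner-orientation c oh ov
  ... | no  _ | inj₂ (ov , refl) | inj₁ (oh , refl) = map₂ swap (corner-orientation c oh ov)
  ... | yes black-c | inj₂ (o , refl) | _ = ⊥-elim (even⇒odd-neighbour (row c) (dy-sign o) black-c black-b)
  ... | yes black-c | inj₁ _ | inj₁ (o , refl) = ⊥-elim (white-w black-c)
  ... | no  white-c | inj₁ (o , refl) | _ = ⊥-elim (white-c black-b)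
  ... | no  white-c | inj₂ _ | inj₂ (o , refl) = ⊥-elim (white-w (odd⇒even-neighbour (row c) (dy-sign o) white-c))

  blackTip-cases : ∀ c o → blackTip c o ≡ tipH c o ⊎ blackTip c o ≡ tipV c o
  blackTip-cases c o with Black? c
  ... | yes _ = inj₁ refl
  ... | no  _ = inj₂ refl

  whiteTip-cases : ∀ c o → whiteTip c o ≡ tipH c o ⊎ whiteTip c o ≡ tipV c o
  whiteTip-cases c o with Black? c
  ... | yes _ = inj₂ refl
  ... | no  _ = inj₁ refl

open FiniteSums
open Indicators
open TrominoGeometry

open import Data.Nat using (_+_; _≤_; _≟_)
open import Data.Nat.Properties
open import Data.Fin using (Fin)
import Data.Fin.Properties as Fin
import Data.Bool as Bool
open import Data.Product using (_,_; proj₁; proj₂; ∃; ∃₂)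
open import Data.Product.Properties using (≡-dec)
open import Data.Sum using (_⊎_; inj₁; inj₂)
open import Data.Empty using (⊥-elim)
import Data.Integer as ℤ
open import Data.List.Membership.Propositional using (_∉_)
open import Data.List.Membership.Propositional.Properties using (∈-lookup)
import Data.List.Relation.Unary.All as All
open import Data.List.Relation.Unary.Any using (here; index)
open import Data.List.Relation.Unary.Any.Properties using (lookup-index)
open import Data.Vec using (Vec; tabulate; lookup)
open import Data.Vec.Properties using (lookup∘tabulate)
open import Function using (_∘_)
open import Function.Bundles using (mk⇔)
open import Relation.Nullary using (¬_; ¬?; Dec; yes; no; does)
open import Relation.Nullary.Decidable using (dec-true; does-⇔; decidable-stable; _×-dec_; _⊎-dec_)
open import Relation.Binary using (DecidableEquality)
open import Relation.Binary.PropositionalEquality hiding ([_])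

Bijection-trans : ∀ {X Y Z : Set} {A : X → Set} {B : Y → Set} {C : Z → Set} →
                  Bijection A B → Bijection B C → Bijection A C
Bijection-trans f g = record
  { to      = G.to ∘ F.to
  ; from    = F.from ∘ G.from
  ; to-ok   = λ x a → G.to-ok _ (F.to-ok x a)
  ; from-ok = λ z c → F.from-ok _ (G.from-ok z c)
  ; from-to = λ x a → trans (cong F.from (G.from-to _ (F.to-ok x a))) (F.from-to x a)
  ; to-from = λ z c → trans (cong G.to (F.to-from _ (G.from-ok z c))) (G.to-from z c)
  }
  where module F = Bijection f
        module G = Bijection g

_≟ᶜ_ : DecidableEquality Cell
_≟ᶜ_ = ≡-dec ℤ._≟_ ℤ._≟_

open import Data.List.Membership.DecPropositional _≟ᶜ_ using (_∈?_)

module RegionNetwork (R P : List Cell) (R-unique : Unique R) (P-unique : Unique P) (P⊆R : All (_∈ R) P) where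

  n : ℕ
  n = length R

  cell : Fin n → Cell
  cell = cellAt R

  cell-injective : ∀ i j → cell i ≡ cell j → i ≡ j
  cell-injective = lookup-injective R-unique

  InP? : ∀ i → Dec (InP R P i)
  InP? i = cell i ∈? P

  InB? : ∀ i → Dec (InB R P i)
  InB? i = ¬? (InP? i) ×-dec Black? (cell i)

  InW? : ∀ i → Dec (InW R P i)
  InW? i = ¬? (InP? i) ×-dec ¬? (Black? (cell i))

  MidEdge? : ∀ i j → Dec (MidEdge R P i j)
  MidEdge? i j = (InB? i ×-dec InP? j ×-dec Adjacent? (cell i) (cell j))
           ⊎-dec (InP? i ×-dec InW? j ×-dec Adjacent? (cell i) (cell j))
    where
    Adjacent? : ∀ c d → Dec (Adjacent c d)
    Adjacent? c d = _ ≟ 1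

  data Class (i : Fin n) : Set where
    peg   : InP R P i → Class i
    black : InB R P i → Class i
    white : InW R P i → Class i

  -- Opaque, so that `with classify i` can abstract it in goals mentioning χP, χB and χW.
  opaque
    classify : ∀ i → Class i
    classify i with InP? i | Black? (cell i)
    ... | yes p   | _       = peg p
    ... | no  p∉P | yes b   = black (p∉P , b)
    ... | no  p∉P | no  ¬b  = white (p∉P , ¬b)

  χP χB χW : Fin n → ℕ
  χP i with classify i
  ... | peg _ = 1
  ... | _     = 0
  χB i with classify i
  ... | black _ = 1
  ... | _       = 0
  χW i with classify i
  ... | white _ = 1
  ... | _       = 0

  χP-peg : ∀ {i} → InP R P i → χP i ≡ 1
  χP-peg {i} p with classify i
  ... | peg _         = refl
  ... | black (p∉ , _) = ⊥-elim (p∉ p)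
  ... | white (p∉ , _) = ⊥-elim (p∉ p)

  χB-black : ∀ {i} → InB R P i → χB i ≡ 1
  χB-black {i} (p∉ , b) with classify i
  ... | black _       = refl
  ... | peg p         = ⊥-elim (p∉ p)
  ... | white (_ , ¬b) = ⊥-elim (¬b b)

  χW-white : ∀ {i} → InW R P i → χW i ≡ 1
  χW-white {i} (p∉ , ¬b) with classify i
  ... | white _       = refl
  ... | peg p         = ⊥-elim (p∉ p)
  ... | black (_ , b) = ⊥-elim (¬b b)

  χP-non-peg : ∀ {i} → ¬ InP R P i → χP i ≡ 0
  χP-non-peg {i} ¬p with classify i
  ... | peg p   = ⊥-elim (¬p p)
  ... | black _ = refl
  ... | white _ = refl

  χB-non-black : ∀ {i} → ¬ InB R P i → χB i ≡ 0
  χB-non-black {i} ¬b with classify i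
  ... | black b = ⊥-elim (¬b b)
  ... | peg _   = refl
  ... | white _ = refl

  χW-non-white : ∀ {i} → ¬ InW R P i → χW i ≡ 0
  χW-non-white {i} ¬w with classify i
  ... | white w = ⊥-elim (¬w w)
  ... | peg _   = refl
  ... | black _ = refl

  χ-partition : ∀ i → χP i + (χB i + χW i) ≡ 1
  χ-partition i with classify i
  ... | peg _   = refl
  ... | black _ = refl
  ... | white _ = refl

  χB≤1 : ∀ i → χB i ≤ 1
  χB≤1 i = ≤-trans (≤-trans (m≤m+n (χB i) (χW i)) (m≤n+m _ (χP i))) (≤-reflexive (χ-partition i))

  χW≤1 : ∀ i → χW i ≤ 1
  χW≤1 i = ≤-trans (≤-trans (m≤n+m (χW i) (χB i)) (m≤n+m _ (χP i))) (≤-reflexive (χ-partition i))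

  ∑χP : ∑[ i < n ] χP i ≡ length P
  ∑χP = trans (sum-cong-≗ 𝟙-membership) (count-∈ _≟ᶜ_ P R-unique P-unique P⊆R)
    where
    𝟙-membership : ∀ i → χP i ≡ 𝟙 (InP? i)
    𝟙-membership i with InP? i
    ... | yes p = χP-peg p
    ... | no ¬p = χP-non-peg ¬p

  ∑χB+χW : 3 * length P ≡ n → ∑[ i < n ] (χB i + χW i) ≡ 2 * length P
  ∑χB+χW 3|P|≡n = +-cancelˡ-≡ (length P) (∑[ i < n ] (χB i + χW i)) (2 * length P) (begin
    length P + ∑[ i < n ] (χB i + χW i)            ≡⟨ cong (_+ ∑[ i < n ] (χB i + χW i)) ∑χP ⟨
    ∑[ i < n ] χP i + ∑[ i < n ] (χB i + χW i)     ≡⟨ ∑-distrib-+ χP (λ i → χB i + χW i) ⟨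
    ∑[ i < n ] (χP i + (χB i + χW i))              ≡⟨ sum-cong-≗ χ-partition ⟩
    ∑[ i < n ] 1                                   ≡⟨ ∑-const-1 n ⟩
    n                                              ≡⟨ 3|P|≡n ⟨
    3 * length P                                   ∎)
    where open ≡-Reasoning

  -- Routings

  Matrix : Set
  Matrix = Vec (Vec ℕ n) n

  _[_,_] : Matrix → Fin n → Fin n → ℕ
  M [ i , j ] = lookup (lookup M i) j

  outdeg indeg : Matrix → Fin n → ℕ
  outdeg M i = ∑[ j < n ] M [ i , j ]
  indeg  M j = ∑[ i < n ] M [ i , j ]

  AlongEdges : Matrix → Set
  AlongEdges M = ∀ i j → M [ i , j ] ≢ 0 → MidEdge R P i j

  -- The restriction of a flow of value |P| to the edges between cell vertices.
  record IsRouting (M : Matrix) : Set where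
    field
      along-edges : AlongEdges M
      entry≤1     : ∀ i j → M [ i , j ] ≤ 1
      indeg≤1     : ∀ i → indeg M i ≤ 1
      outdeg≤1    : ∀ i → outdeg M i ≤ 1
      peg-indeg   : ∀ p → InP R P p → indeg M p ≡ 1
      peg-outdeg  : ∀ p → InP R P p → outdeg M p ≡ 1

    in-neighbour-unique : ∀ {i i′ j} → M [ i , j ] ≢ 0 → M [ i′ , j ] ≢ 0 → i ≡ i′
    in-neighbour-unique {i} {i′} {j} = ∑≤1⇒nonzero-unique (λ k → M [ k , j ]) (indeg≤1 j) i i′

    out-neighbour-unique : ∀ {i j j′} → M [ i , j ] ≢ 0 → M [ i , j′ ] ≢ 0 → j ≡ j′
    out-neighbour-unique {i} {j} {j′} = ∑≤1⇒nonzero-unique (λ k → M [ i , k ]) (outdeg≤1 i) j j′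

    peg-in-neighbour : ∀ {p} → InP R P p → ∃ λ b → M [ b , p ] ≢ 0
    peg-in-neighbour {p} p∈P = ∑≢0⇒nonzero (λ k → M [ k , p ]) (≡1⇒≢0 (peg-indeg p p∈P))

    peg-out-neighbour : ∀ {p} → InP R P p → ∃ λ w → M [ p , w ] ≢ 0
    peg-out-neighbour {p} p∈P = ∑≢0⇒nonzero (λ k → M [ p , k ]) (≡1⇒≢0 (peg-outdeg p p∈P))

  χB-along-edge : ∀ {i j} → MidEdge R P i j → χB i ≡ χP j
  χB-along-edge (inj₁ (b , p , _)) = trans (χB-black b) (sym (χP-peg p))
  χB-along-edge (inj₂ (p , w , _)) = trans (χB-non-black (λ b → proj₁ b p)) (sym (χP-non-peg (proj₁ w)))

  χW-along-edge : ∀ {i j} → MidEdge R P i j → χW j ≡ χP i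
  χW-along-edge (inj₁ (b , p , _)) = trans (χW-non-white (λ w → proj₁ w p)) (sym (χP-non-peg (proj₁ b)))
  χW-along-edge (inj₂ (p , w , _)) = trans (χW-white w) (sym (χP-peg p))

  module _ {M : Matrix} (along : AlongEdges M) where

    black-indeg≡0 : ∀ {i} → InB R P i → indeg M i ≡ 0
    black-indeg≡0 {i} (p∉ , b) = ∑-zero λ k → decidable-stable (M [ k , i ] ≟ 0) λ ne → case (along k i ne)
      where
      case : ∀ {k} → ¬ MidEdge R P k i
      case (inj₁ (_ , p , _))        = p∉ p
      case (inj₂ (_ , (_ , ¬b) , _)) = ¬b b

    white-outdeg≡0 : ∀ {i} → InW R P i → outdeg M i ≡ 0
    white-outdeg≡0 {i} (p∉ , ¬b) = ∑-zero λ k → decidable-stable (M [ i , k ] ≟ 0) λ ne → case (along i k ne)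
      where
      case : ∀ {k} → ¬ MidEdge R P i k
      case (inj₁ ((_ , b) , _ , _)) = ¬b b
      case (inj₂ (p , _ , _))       = p∉ p

    ∑-black-outdeg : ∑[ i < n ] (χB i * outdeg M i) ≡ ∑[ j < n ] (χP j * indeg M j)
    ∑-black-outdeg = double-count (λ i j → M [ i , j ]) χB χP λ i j ne → χB-along-edge (along i j ne)

    ∑-white-indeg : ∑[ j < n ] (χW j * indeg M j) ≡ ∑[ i < n ] (χP i * outdeg M i)
    ∑-white-indeg = double-count (λ j i → M [ i , j ]) χW χP λ j i ne → χW-along-edge (along i j ne)

  module PegSums {M : Matrix} (routing : IsRouting M) where
    open IsRouting routing

    ∑-black-outdeg≡|P| : ∑[ i < n ] (χB i * outdeg M i) ≡ length P
    ∑-black-outdeg≡|P| = trans (∑-black-outdeg {M} along-edges) (trans (sum-cong-≗ peg-term) ∑χP)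
      where
      peg-term : ∀ j → χP j * indeg M j ≡ χP j
      peg-term j with classify j
      ... | peg p   = trans (*-identityˡ _) (peg-indeg j p)
      ... | black _ = refl
      ... | white _ = refl

    ∑-white-indeg≡|P| : ∑[ i < n ] (χW i * indeg M i) ≡ length P
    ∑-white-indeg≡|P| = trans (∑-white-indeg {M} along-edges) (trans (sum-cong-≗ peg-term) ∑χP)
      where
      peg-term : ∀ j → χP j * outdeg M j ≡ χP j
      peg-term j with classify j
      ... | peg p   = trans (*-identityˡ _) (peg-outdeg j p)
      ... | black _ = refl
      ... | white _ = refl

  module Saturation {M : Matrix} (routing : IsRouting M) (3|P|≡n : 3 * length P ≡ n) where
    open IsRouting routing
    open PegSums routing

    saturated : ∀ i → χB i * outdeg M i + χW i * indeg M i ≡ χB i + χW i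
    saturated = ∑-mono-≤-≡⇒≡ bounded (begin
      ∑[ i < n ] (χB i * outdeg M i + χW i * indeg M i)
        ≡⟨ ∑-distrib-+ (λ i → χB i * outdeg M i) (λ i → χW i * indeg M i) ⟩
      ∑[ i < n ] (χB i * outdeg M i) + ∑[ i < n ] (χW i * indeg M i)
        ≡⟨ cong₂ _+_ ∑-black-outdeg≡|P| ∑-white-indeg≡|P| ⟩
      length P + length P
        ≡⟨ cong (length P +_) (+-identityʳ (length P)) ⟨
      2 * length P
        ≡⟨ ∑χB+χW 3|P|≡n ⟨
      ∑[ i < n ] (χB i + χW i) ∎)
      where
      open ≡-Reasoning
      bounded : ∀ i → χB i * outdeg M i + χW i * indeg M i ≤ χB i + χW i
      bounded i = +-mono-≤ (≤-trans (*-monoʳ-≤ (χB i) (outdeg≤1 i)) (≤-reflexive (*-identityʳ (χB i))))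
                           (≤-trans (*-monoʳ-≤ (χW i) (indeg≤1 i)) (≤-reflexive (*-identityʳ (χW i))))

    black-outdeg≡1 : ∀ {i} → InB R P i → outdeg M i ≡ 1
    black-outdeg≡1 {i} b with saturated i
    ... | eq rewrite χB-black b | χW-non-white (λ w → proj₂ w (proj₂ b)) =
      trans (sym (+-identityʳ (outdeg M i))) (trans (sym (+-identityʳ (outdeg M i + 0))) eq)

    white-indeg≡1 : ∀ {i} → InW R P i → indeg M i ≡ 1
    white-indeg≡1 {i} w with saturated i
    ... | eq rewrite χW-white w | χB-non-black (λ b → proj₂ w (proj₂ b)) =
      trans (sym (+-identityʳ (indeg M i))) eq

  -- Flows of value |P| and routings

  inflow≡ : ∀ (f : FlowData n) i → inflow f i ≡ lookup (src f) i + indeg (mid f) i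
  inflow≡ f i = cong (lookup (src f) i +_) (sum-tabulate (λ j → mid f [ j , i ]))

  outflow≡ : ∀ (f : FlowData n) i → outflow f i ≡ lookup (snk f) i + outdeg (mid f) i
  outflow≡ f i = cong (lookup (snk f) i +_) (sum-tabulate (λ j → mid f [ i , j ]))

  flowOf : Matrix → FlowData n
  flowOf M = flowData (tabulate λ i → χB i * outdeg M i) (tabulate λ i → χW i * indeg M i) M

  module RoutingToFlow {M : Matrix} (routing : IsRouting M) where
    open IsRouting routing
    open PegSums routing

    src-flowOf : ∀ i → lookup (src (flowOf M)) i ≡ χB i * outdeg M i
    src-flowOf = lookup∘tabulate (λ i → χB i * outdeg M i)

    snk-flowOf : ∀ i → lookup (snk (flowOf M)) i ≡ χW i * indeg M i
    snk-flowOf = lookup∘tabulate (λ i → χW i * indeg M i)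

    conserved : ∀ i → χB i * outdeg M i + indeg M i ≡ χW i * indeg M i + outdeg M i
    conserved i with classify i
    ... | peg p   = trans (peg-indeg i p) (sym (peg-outdeg i p))
    ... | black b = trans (cong₂ _+_ (+-identityʳ (outdeg M i)) (black-indeg≡0 {M} along-edges b))
                          (+-identityʳ (outdeg M i))
    ... | white w = sym (trans (cong₂ _+_ (+-identityʳ (indeg M i)) (white-outdeg≡0 {M} along-edges w))
                               (+-identityʳ (indeg M i)))

    through≤1 : ∀ i → χB i * outdeg M i + indeg M i ≤ 1
    through≤1 i with classify i | conserved i
    ... | peg _   | _  = indeg≤1 i
    ... | white _ | _  = indeg≤1 i
    ... | black _ | eq = subst (_≤ 1) (sym eq) (outdeg≤1 i)

    inflow-flowOf : ∀ i → inflow (flowOf M) i ≡ χB i * outdeg M i + indeg M i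
    inflow-flowOf i = trans (inflow≡ (flowOf M) i) (cong (_+ indeg M i) (src-flowOf i))

    outflow-flowOf : ∀ i → outflow (flowOf M) i ≡ χW i * indeg M i + outdeg M i
    outflow-flowOf i = trans (outflow≡ (flowOf M) i) (cong (_+ outdeg M i) (snk-flowOf i))

    flowOf-isFlow : IsFlow R P (flowOf M)
    flowOf-isFlow = record
      { srcSupport = λ i ¬b → trans (src-flowOf i) (cong (_* outdeg M i) (χB-non-black ¬b))
      ; snkSupport = λ i ¬w → trans (snk-flowOf i) (cong (_* indeg M i) (χW-non-white ¬w))
      ; midSupport = λ i j ¬e → decidable-stable (M [ i , j ] ≟ 0) (¬e ∘ along-edges i j)
      ; srcCap     = λ i → subst (_≤ 1) (sym (src-flowOf i)) (*-mono-≤ (χB≤1 i) (outdeg≤1 i))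
      ; snkCap     = λ i → subst (_≤ 1) (sym (snk-flowOf i)) (*-mono-≤ (χW≤1 i) (indeg≤1 i))
      ; midCap     = entry≤1
      ; vertexCap  = λ i → subst (_≤ 1) (sym (inflow-flowOf i)) (through≤1 i)
      ; conserve   = λ i → trans (inflow-flowOf i) (trans (conserved i) (sym (outflow-flowOf i)))
      }

    flowOf-value : value (flowOf M) ≡ length P
    flowOf-value = trans (sum-tabulate (λ i → χB i * outdeg M i)) ∑-black-outdeg≡|P|

  module FlowToRouting {f : FlowData n} (flow : IsFlow R P f) (value≡ : value f ≡ length P) where
    open IsFlow flow

    M : Matrix
    M = mid f

    s t : Fin n → ℕ
    s i = lookup (src f) i
    t i = lookup (snk f) i

    along-edges : AlongEdges M
    along-edges i j Mij≢0 with MidEdge? i j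
    ... | yes e = e
    ... | no ¬e = ⊥-elim (Mij≢0 (midSupport i j ¬e))

    indeg≤1 : ∀ i → indeg M i ≤ 1
    indeg≤1 i = ≤-trans (m≤n+m (indeg M i) (s i)) (subst (_≤ 1) (inflow≡ f i) (vertexCap i))

    outdeg≤1 : ∀ i → outdeg M i ≤ 1
    outdeg≤1 i = ≤-trans (m≤n+m (outdeg M i) (t i))
                         (subst (_≤ 1) (trans (conserve i) (outflow≡ f i)) (vertexCap i))

    balance : ∀ i → s i + indeg M i ≡ t i + outdeg M i
    balance i = trans (sym (inflow≡ f i)) (trans (conserve i) (outflow≡ f i))

    src≡ : ∀ i → s i ≡ χB i * outdeg M i
    src≡ i with classify i
    ... | peg p   = srcSupport i (λ b → proj₁ b p)
    ... | white w = srcSupport i (λ b → proj₂ w (proj₂ b))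
    ... | black b = begin
      s i                  ≡⟨ +-identityʳ (s i) ⟨
      s i + 0              ≡⟨ cong (s i +_) (black-indeg≡0 {M} along-edges b) ⟨
      s i + indeg M i      ≡⟨ balance i ⟩
      t i + outdeg M i     ≡⟨ cong (_+ outdeg M i) (snkSupport i (λ w → proj₂ w (proj₂ b))) ⟩
      outdeg M i           ≡⟨ +-identityʳ (outdeg M i) ⟨
      outdeg M i + 0       ∎
      where open ≡-Reasoning

    snk≡ : ∀ i → t i ≡ χW i * indeg M i
    snk≡ i with classify i
    ... | peg p   = snkSupport i (λ w → proj₁ w p)
    ... | black b = snkSupport i (λ w → proj₂ w (proj₂ b))
    ... | white w = begin
      t i                  ≡⟨ +-identityʳ (t i) ⟨
      t i + 0              ≡⟨ cong (t i +_) (white-outdeg≡0 {M} along-edges w) ⟨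
      t i + outdeg M i     ≡⟨ balance i ⟨
      s i + indeg M i      ≡⟨ cong (_+ indeg M i) (srcSupport i (λ b → proj₂ w (proj₂ b))) ⟩
      indeg M i            ≡⟨ +-identityʳ (indeg M i) ⟨
      indeg M i + 0        ∎
      where open ≡-Reasoning

    pegs-saturated : ∀ j → χP j * indeg M j ≡ χP j
    pegs-saturated = ∑-mono-≤-≡⇒≡ bounded (begin
      ∑[ j < n ] (χP j * indeg M j)   ≡⟨ ∑-black-outdeg {M} along-edges ⟨
      ∑[ i < n ] (χB i * outdeg M i)  ≡⟨ sum-cong-≗ src≡ ⟨
      ∑[ i < n ] s i                  ≡⟨ sum-lookup (src f) ⟨
      value f                         ≡⟨ value≡ ⟩
      length P                        ≡⟨ ∑χP ⟨
      ∑[ j < n ] χP j                 ∎)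
      where
      open ≡-Reasoning
      bounded : ∀ j → χP j * indeg M j ≤ χP j
      bounded j = ≤-trans (*-monoʳ-≤ (χP j) (indeg≤1 j)) (≤-reflexive (*-identityʳ (χP j)))

    peg-indeg : ∀ p → InP R P p → indeg M p ≡ 1
    peg-indeg p p∈P with classify p | pegs-saturated p
    ... | peg _          | eq = trans (sym (+-identityʳ (indeg M p))) eq
    ... | black (p∉ , _) | _  = ⊥-elim (p∉ p∈P)
    ... | white (p∉ , _) | _  = ⊥-elim (p∉ p∈P)

    peg-outdeg : ∀ p → InP R P p → outdeg M p ≡ 1
    peg-outdeg p p∈P = begin
      outdeg M p          ≡⟨ cong (_+ outdeg M p) (snkSupport p (λ w → proj₁ w p∈P)) ⟨
      t p + outdeg M p    ≡⟨ balance p ⟨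
      s p + indeg M p     ≡⟨ cong (_+ indeg M p) (srcSupport p (λ b → proj₁ b p∈P)) ⟩
      indeg M p           ≡⟨ peg-indeg p p∈P ⟩
      1                   ∎
      where open ≡-Reasoning

    mid-isRouting : IsRouting M
    mid-isRouting = record
      { along-edges = along-edges
      ; entry≤1     = midCap
      ; indeg≤1     = indeg≤1
      ; outdeg≤1    = outdeg≤1
      ; peg-indeg   = peg-indeg
      ; peg-outdeg  = peg-outdeg
      }

    flowOf-mid : flowOf M ≡ f
    flowOf-mid = cong₂ (λ a b → flowData a b M)
      (Vec-ext λ i → trans (lookup∘tabulate (λ i → χB i * outdeg M i) i) (sym (src≡ i)))
      (Vec-ext λ i → trans (lookup∘tabulate (λ i → χW i * indeg M i) i) (sym (snk≡ i)))

  routing↔flow : Bijection IsRouting (λ f → IsFlow R P f × value f ≡ length P)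
  routing↔flow = record
    { to      = flowOf
    ; from    = mid
    ; to-ok   = λ M routing → RoutingToFlow.flowOf-isFlow routing , RoutingToFlow.flowOf-value routing
    ; from-ok = λ f (flow , value≡) → FlowToRouting.mid-isRouting flow value≡
    ; from-to = λ M _ → refl
    ; to-from = λ f (flow , value≡) → FlowToRouting.flowOf-mid flow value≡
    }

  -- p-covers and routings

  Selected? : ∀ (S : TrominoSet R) i o → Dec (Selected R S i o)
  Selected? S i o = lookup (lookup S i) o Bool.≟ Bool.true

  BlackTipOf WhiteTipOf : TrominoSet R → Fin n → Fin n → Set
  BlackTipOf S b p = ∃ λ o → Selected R S p o × cell b ≡ blackTip (cell p) o
  WhiteTipOf S w p = ∃ λ o → Selected R S p o × cell w ≡ whiteTip (cell p) o

  CoverEdge : TrominoSet R → Fin n → Fin n → Set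
  CoverEdge S i j = BlackTipOf S i j ⊎ WhiteTipOf S j i

  CoverEdge? : ∀ S i j → Dec (CoverEdge S i j)
  CoverEdge? S i j = Fin.any? (λ o → Selected? S j o ×-dec cell i ≟ᶜ blackTip (cell j) o)
               ⊎-dec Fin.any? (λ o → Selected? S i o ×-dec cell j ≟ᶜ whiteTip (cell i) o)

  -- Opaque (like coverOf): only the entry lemmas are used, and unfolding the tabulations makes
  -- unification and with-abstraction very expensive.
  opaque
    routingOf : TrominoSet R → Matrix
    routingOf S = tabulate λ i → tabulate λ j → 𝟙 (CoverEdge? S i j)

    routingOf-entry : ∀ S i j → routingOf S [ i , j ] ≡ 𝟙 (CoverEdge? S i j)
    routingOf-entry S = lookup²∘tabulate² (λ i j → 𝟙 (CoverEdge? S i j))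

  RoutedTromino : Matrix → Fin n → Fin 4 → Set
  RoutedTromino M p o = InP R P p × (∃ λ b → cell b ≡ blackTip (cell p) o × M [ b , p ] ≢ 0)
                                   × (∃ λ w → cell w ≡ whiteTip (cell p) o × M [ p , w ] ≢ 0)

  RoutedTromino? : ∀ M p o → Dec (RoutedTromino M p o)
  RoutedTromino? M p o = InP? p
    ×-dec Fin.any? (λ b → cell b ≟ᶜ blackTip (cell p) o ×-dec ¬? (M [ b , p ] ≟ 0))
    ×-dec Fin.any? (λ w → cell w ≟ᶜ whiteTip (cell p) o ×-dec ¬? (M [ p , w ] ≟ 0))

  opaque
    coverOf : Matrix → TrominoSet R
    coverOf M = tabulate λ p → tabulate λ o → does (RoutedTromino? M p o)

    coverOf-entry : ∀ M p o → lookup (lookup (coverOf M) p) o ≡ does (RoutedTromino? M p o)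
    coverOf-entry M = lookup²∘tabulate² (λ p o → does (RoutedTromino? M p o))

  selected-coverOf⁺ : ∀ {M p o} → RoutedTromino M p o → Selected R (coverOf M) p o
  selected-coverOf⁺ {M} {p} {o} routed =
    trans (coverOf-entry M p o) (dec-true (RoutedTromino? M p o) routed)

  selected-coverOf⁻ : ∀ {M p o} → Selected R (coverOf M) p o → RoutedTromino M p o
  selected-coverOf⁻ {M} {p} {o} selected =
    does≡true⇒ (RoutedTromino? M p o) (trans (sym (coverOf-entry M p o)) selected)

  module CoverToRouting {S : TrominoSet R} (cover : IsPCover R P S) where
    open IsPCover cover

    M : Matrix
    M = routingOf S

    orientation-unique : ∀ {p o o′} → Selected R S p o → Selected R S p o′ → o ≡ o′
    orientation-unique {p} {o} {o′} s s′ = proj₂ (disjoint p o p o′ (cell p) s s′ (here refl) (here refl))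

    blackTip∉P : ∀ {p o} → Selected R S p o → blackTip (cell p) o ∉ P
    blackTip∉P {p} {o} s with blackTip-cases (cell p) o
    ... | inj₁ eq = subst (_∉ P) (sym eq) (tipHNotInP p o s)
    ... | inj₂ eq = subst (_∉ P) (sym eq) (tipVNotInP p o s)

    whiteTip∉P : ∀ {p o} → Selected R S p o → whiteTip (cell p) o ∉ P
    whiteTip∉P {p} {o} s with whiteTip-cases (cell p) o
    ... | inj₁ eq = subst (_∉ P) (sym eq) (tipHNotInP p o s)
    ... | inj₂ eq = subst (_∉ P) (sym eq) (tipVNotInP p o s)

    black-tip-InB : ∀ {b p} → BlackTipOf S b p → InB R P b
    black-tip-InB {p = p} (o , s , eq) =
      subst (_∉ P) (sym eq) (blackTip∉P s) , subst Black (sym eq) (blackTip-black (cell p) o)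

    white-tip-InW : ∀ {w p} → WhiteTipOf S w p → InW R P w
    white-tip-InW {p = p} (o , s , eq) =
      subst (_∉ P) (sym eq) (whiteTip∉P s) , subst (¬_ ∘ Black) (sym eq) (whiteTip-white (cell p) o)

    edge-along : ∀ {i j} → CoverEdge S i j → MidEdge R P i j
    edge-along {i} {j} (inj₁ t@(o , s , eq)) =
      inj₁ (black-tip-InB t , cornerInP j o s ,
            subst (λ c → Adjacent c (cell j)) (sym eq) (blackTip-adjacent (cell j) o))
    edge-along {i} {j} (inj₂ t@(o , s , eq)) =
      inj₂ (cornerInP i o s , white-tip-InW t , subst (Adjacent (cell i)) (sym eq) (whiteTip-adjacent (cell i) o))

    black-tip-unique : ∀ {b p p′} → BlackTipOf S b p → BlackTipOf S b p′ → p ≡ p′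
    black-tip-unique {b} {p} {p′} (o , s , eq) (o′ , s′ , eq′) =
      proj₁ (disjoint p o p′ o′ (cell b) s s′ 
                         (subst (_∈ cellsOf R p o) (sym eq) (blackTip-∈ (cell p) o))
                         (subst (_∈ cellsOf R p′ o′) (sym eq′) (blackTip-∈ (cell p′) o′)))

    white-tip-unique : ∀ {w p p′} → WhiteTipOf S w p → WhiteTipOf S w p′ → p ≡ p′
    white-tip-unique {w} {p} {p′} (o , s , eq) (o′ , s′ , eq′) =
      proj₁ (disjoint p o p′ o′ (cell w) s s′ 
                         (subst (_∈ cellsOf R p o) (sym eq) (whiteTip-∈ (cell p) o))
                         (subst (_∈ cellsOf R p′ o′) (sym eq′) (whiteTip-∈ (cell p′) o′)))

    corner∉tips : ∀ {i j o} → Selected R S i o → ¬ BlackTipOf S i j × ¬ WhiteTipOf S i j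
    corner∉tips {i} {j} {o} s =
      (λ t → proj₁ (black-tip-InB t) (cornerInP i o s)) , (λ t → proj₁ (white-tip-InW t) (cornerInP i o s))

    out-unique : ∀ {i j j′} → CoverEdge S i j → CoverEdge S i j′ → j ≡ j′
    out-unique (inj₁ t) (inj₁ t′) = black-tip-unique t t′
    out-unique {i} {j} {j′} (inj₂ (o , s , eq)) (inj₂ (o′ , s′ , eq′)) =
      cell-injective j j′ (trans eq (trans (cong (whiteTip (cell i)) (orientation-unique s s′)) (sym eq′)))
    out-unique (inj₁ t) (inj₂ (_ , s′ , _)) = ⊥-elim (proj₁ (corner∉tips s′) t)
    out-unique (inj₂ (_ , s , _)) (inj₁ t′) = ⊥-elim (proj₁ (corner∉tips s) t′)

    in-unique : ∀ {i i′ j} → CoverEdge S i j → CoverEdge S i′ j → i ≡ i′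
    in-unique {i} {i′} {j} (inj₁ (o , s , eq)) (inj₁ (o′ , s′ , eq′)) =
      cell-injective i i′ (trans eq (trans (cong (blackTip (cell j)) (orientation-unique s s′)) (sym eq′)))
    in-unique (inj₂ t) (inj₂ t′) = white-tip-unique t t′
    in-unique (inj₁ (_ , s , _)) (inj₂ t′) = ⊥-elim (proj₂ (corner∉tips s) t′)
    in-unique (inj₂ t) (inj₁ (_ , s′ , _)) = ⊥-elim (proj₂ (corner∉tips s′) t)

    peg-selected : ∀ {p} → InP R P p → ∃ λ o → Selected R S p o
    peg-selected {p} p∈P with covers (cell p) (∈-lookup p)
    ... | i , o , s , m with ∈-trominoCells⁻ {cell i} {o} m
    ...   | inj₁ eq        = o , subst (λ k → Selected R S k o) (cell-injective i p (sym eq)) s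
    ...   | inj₂ (inj₁ eq) = ⊥-elim (blackTip∉P s (subst (_∈ P) eq p∈P))
    ...   | inj₂ (inj₂ eq) = ⊥-elim (whiteTip∉P s (subst (_∈ P) eq p∈P))

    black-tip-index : ∀ {p o} → Selected R S p o → ∃ λ b → cell b ≡ blackTip (cell p) o
    black-tip-index {p} {o} s = index b∈R , sym (lookup-index b∈R)
      where
      b∈R : blackTip (cell p) o ∈ R
      b∈R = All.lookup (contained p o s) (blackTip-∈ (cell p) o)

    white-tip-index : ∀ {p o} → Selected R S p o → ∃ λ w → cell w ≡ whiteTip (cell p) o
    white-tip-index {p} {o} s = index w∈R , sym (lookup-index w∈R)
      where
      w∈R : whiteTip (cell p) o ∈ R
      w∈R = All.lookup (contained p o s) (whiteTip-∈ (cell p) o)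

    entry : ∀ i j → M [ i , j ] ≡ 𝟙 (CoverEdge? S i j)
    entry = routingOf-entry S

    edge-of-entry : ∀ {i j} → M [ i , j ] ≢ 0 → CoverEdge S i j
    edge-of-entry {i} {j} Mij≢0 = 𝟙≢0⇒ (CoverEdge? S i j) (Mij≢0 ∘ trans (entry i j))

    entry-of-edge : ∀ {i j} → CoverEdge S i j → M [ i , j ] ≡ 1
    entry-of-edge {i} {j} e = trans (entry i j) (𝟙-yes (CoverEdge? S i j) e)

    entry≤1 : ∀ i j → M [ i , j ] ≤ 1
    entry≤1 i j = subst (_≤ 1) (sym (entry i j)) (𝟙≤1 (CoverEdge? S i j))

    routingOf-isRouting : IsRouting M
    routingOf-isRouting = record
      { along-edges = λ i j Mij≢0 → edge-along (edge-of-entry Mij≢0)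
      ; entry≤1     = entry≤1
      ; indeg≤1     = indeg≤1
      ; outdeg≤1    = outdeg≤1
      ; peg-indeg   = peg-indeg
      ; peg-outdeg  = peg-outdeg
      }
      where
      indeg≤1 : ∀ j → indeg M j ≤ 1
      indeg≤1 j = nonzero-unique⇒∑≤1 (λ i → M [ i , j ]) (λ i → entry≤1 i j)
                    λ i i′ Mij≢0 Mi′j≢0 → in-unique (edge-of-entry Mij≢0) (edge-of-entry Mi′j≢0)

      outdeg≤1 : ∀ i → outdeg M i ≤ 1
      outdeg≤1 i = nonzero-unique⇒∑≤1 (λ j → M [ i , j ]) (entry≤1 i)
                     λ j j′ Mij≢0 Mij′≢0 → out-unique (edge-of-entry Mij≢0) (edge-of-entry Mij′≢0)

      peg-indeg : ∀ p → InP R P p → indeg M p ≡ 1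
      peg-indeg p p∈P with peg-selected p∈P
      ... | o , s with black-tip-index s
      ...   | b , eq = ∑≤1∧term≡1⇒∑≡1 (λ k → M [ k , p ]) b (indeg≤1 p) (entry-of-edge (inj₁ (o , s , eq)))

      peg-outdeg : ∀ p → InP R P p → outdeg M p ≡ 1
      peg-outdeg p p∈P with peg-selected p∈P
      ... | o , s with white-tip-index s
      ...   | w , eq = ∑≤1∧term≡1⇒∑≡1 (λ k → M [ p , k ]) w (outdeg≤1 p) (entry-of-edge (inj₂ (o , s , eq)))

    selected⇒routed : ∀ {p o} → Selected R S p o → RoutedTromino M p o
    selected⇒routed {p} {o} s with black-tip-index s | white-tip-index s
    ... | b , eqb | w , eqw =
      cornerInP p o s ,
      (b , eqb , ≡1⇒≢0 (entry-of-edge (inj₁ (o , s , eqb)))) ,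
      (w , eqw , ≡1⇒≢0 (entry-of-edge (inj₂ (o , s , eqw))))

    routed⇒selected : ∀ {p o} → RoutedTromino M p o → Selected R S p o
    routed⇒selected {p} {o} (p∈P , (b , eqb , Mbp≢0) , (w , eqw , Mpw≢0))
      with edge-of-entry Mbp≢0 | edge-of-entry Mpw≢0
    ... | inj₂ t | _ = ⊥-elim (proj₁ (white-tip-InW t) p∈P)
    ... | _ | inj₁ t = ⊥-elim (proj₁ (black-tip-InB t) p∈P)
    ... | inj₁ (o₁ , s₁ , eq₁) | inj₂ (o₂ , s₂ , eq₂) = subst (Selected R S p) (sym o≡o₁) s₁
      where
      o≡o₁ : o ≡ o₁
      o≡o₁ = coloured-tips-injective (cell p)
        (trans (sym eqb) eq₁)
        (trans (sym eqw) (trans eq₂ (cong (whiteTip (cell p)) (orientation-unique s₂ s₁))))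

    coverOf-routingOf : coverOf M ≡ S
    coverOf-routingOf = Vec-ext λ p → Vec-ext λ o → begin
      lookup (lookup (coverOf M) p) o  ≡⟨ coverOf-entry M p o ⟩
      does (RoutedTromino? M p o)      ≡⟨ does-⇔ (mk⇔ routed⇒selected selected⇒routed)
                                                 (RoutedTromino? M p o) (Selected? S p o) ⟩
      does (Selected? S p o)           ≡⟨ does-≟-true (lookup (lookup S p) o) ⟩
      lookup (lookup S p) o            ∎
      where
      open ≡-Reasoning
      does-≟-true : ∀ b → does (b Bool.≟ Bool.true) ≡ b
      does-≟-true Bool.true  = refl
      does-≟-true Bool.false = refl

  module RoutingToCover {M : Matrix} (routing : IsRouting M) where
    open IsRouting routing

    S : TrominoSet R
    S = coverOf M

    in-neighbour-of-peg : ∀ {b p} → InP R P p → M [ b , p ] ≢ 0 → InB R P b × Adjacent (cell b) (cell p)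
    in-neighbour-of-peg {b} {p} p∈P Mbp≢0 with along-edges b p Mbp≢0
    ... | inj₁ (b∈B , _ , b~p)  = b∈B , b~p
    ... | inj₂ (_ , (p∉ , _) , _) = ⊥-elim (p∉ p∈P)

    out-neighbour-of-peg : ∀ {p w} → InP R P p → M [ p , w ] ≢ 0 → InW R P w × Adjacent (cell p) (cell w)
    out-neighbour-of-peg {p} {w} p∈P Mpw≢0 with along-edges p w Mpw≢0
    ... | inj₂ (_ , w∈W , p~w)  = w∈W , p~w
    ... | inj₁ ((p∉ , _) , _ , _) = ⊥-elim (p∉ p∈P)

    peg-routed : ∀ {p} → InP R P p → ∃ λ o → RoutedTromino M p o
    peg-routed {p} p∈P with peg-in-neighbour p∈P | peg-out-neighbour p∈P
    ... | b , Mbp≢0 | w , Mpw≢0 with in-neighbour-of-peg p∈P Mbp≢0 | out-neighbour-of-peg p∈P Mpw≢0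
    ... | (_ , black-b) , b~p | (_ , white-w) , p~w with tromino-with-tips black-b white-w b~p p~w
    ... | o , eqb , eqw = o , p∈P , (b , sym eqb , Mbp≢0) , (w , sym eqw , Mpw≢0)

    black-tip-routed : ∀ {p o b} → RoutedTromino M p o → M [ b , p ] ≢ 0 → cell b ≡ blackTip (cell p) o
    black-tip-routed (_ , (b′ , eq , Mb′p≢0) , _) Mbp≢0 = trans (cong cell (in-neighbour-unique Mbp≢0 Mb′p≢0)) eq

    white-tip-routed : ∀ {p o w} → RoutedTromino M p o → M [ p , w ] ≢ 0 → cell w ≡ whiteTip (cell p) o
    white-tip-routed (_ , _ , (w′ , eq , Mpw′≢0)) Mpw≢0 = trans (cong cell (out-neighbour-unique Mpw≢0 Mpw′≢0)) eq

    routed-unique : ∀ {p o o′} → RoutedTromino M p o → RoutedTromino M p o′ → o ≡ o′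
    routed-unique {p} {o} r (_ , (b , eqb , Mbp≢0) , (w , eqw , Mpw≢0)) =
      coloured-tips-injective (cell p) (trans (sym (black-tip-routed {p} {o} r Mbp≢0)) eqb)
                                       (trans (sym (white-tip-routed {p} {o} r Mpw≢0)) eqw)

    data Role (p : Fin n) (x : Cell) : Set where
      corner   : x ≡ cell p → Role p x
      entering : ∀ {b} → x ≡ cell b → M [ b , p ] ≢ 0 → Role p x
      leaving  : ∀ {w} → x ≡ cell w → M [ p , w ] ≢ 0 → Role p x

    role : ∀ {p o x} → RoutedTromino M p o → x ∈ cellsOf R p o → Role p x
    role {p} {o} r m with ∈-trominoCells⁻ {cell p} {o} m | r
    ... | inj₁ e        | _                         = corner e
    ... | inj₂ (inj₁ e) | _ , (b , eqb , Mbp≢0) , _ = entering (trans e (sym eqb)) Mbp≢0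
    ... | inj₂ (inj₂ e) | _ , _ , (w , eqw , Mpw≢0) = leaving (trans e (sym eqw)) Mpw≢0

    role-determines-corner : ∀ {p p′ x} → InP R P p → InP R P p′ → Role p x → Role p′ x → p ≡ p′
    role-determines-corner {p} {p′} _ _ (corner e) (corner e′) = cell-injective p p′ (trans (sym e) e′)
    role-determines-corner p∈P p′∈P (corner e) (entering e′ Mbp′≢0) =
      ⊥-elim (proj₁ (proj₁ (in-neighbour-of-peg p′∈P Mbp′≢0)) (subst (_∈ P) (trans (sym e) e′) p∈P))
    role-determines-corner p∈P p′∈P (corner e) (leaving e′ Mp′w≢0) =
      ⊥-elim (proj₁ (proj₁ (out-neighbour-of-peg p′∈P Mp′w≢0)) (subst (_∈ P) (trans (sym e) e′) p∈P))
    role-determines-corner p∈P p′∈P (entering e Mbp≢0) (corner e′) =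
      ⊥-elim (proj₁ (proj₁ (in-neighbour-of-peg p∈P Mbp≢0)) (subst (_∈ P) (trans (sym e′) e) p′∈P))
    role-determines-corner p∈P p′∈P (leaving e Mpw≢0) (corner e′) =
      ⊥-elim (proj₁ (proj₁ (out-neighbour-of-peg p∈P Mpw≢0)) (subst (_∈ P) (trans (sym e′) e) p′∈P))
    role-determines-corner {p} {p′} _ _ (entering {b} e Mbp≢0) (entering {b′} e′ Mb′p′≢0)
      with cell-injective b b′ (trans (sym e) e′)
    ... | refl = out-neighbour-unique Mbp≢0 Mb′p′≢0
    role-determines-corner {p} {p′} _ _ (leaving {w} e Mpw≢0) (leaving {w′} e′ Mp′w′≢0)
      with cell-injective w w′ (trans (sym e) e′)
    ... | refl = in-neighbour-unique Mpw≢0 Mp′w′≢0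
    role-determines-corner p∈P p′∈P (entering e Mbp≢0) (leaving e′ Mp′w≢0) =
      ⊥-elim (proj₂ (proj₁ (out-neighbour-of-peg p′∈P Mp′w≢0))
                    (subst Black (trans (sym e) e′) (proj₂ (proj₁ (in-neighbour-of-peg p∈P Mbp≢0)))))
    role-determines-corner p∈P p′∈P (leaving e Mpw≢0) (entering e′ Mbp′≢0) =
      ⊥-elim (proj₂ (proj₁ (out-neighbour-of-peg p∈P Mpw≢0))
                    (subst Black (trans (sym e′) e) (proj₂ (proj₁ (in-neighbour-of-peg p′∈P Mbp′≢0)))))

    tip∉P : ∀ {p o x} → RoutedTromino M p o → x ≡ blackTip (cell p) o ⊎ x ≡ whiteTip (cell p) o → x ∉ P
    tip∉P (p∈P , (b , eqb , Mbp≢0) , _) (inj₁ e) =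
      subst (_∉ P) (trans eqb (sym e)) (proj₁ (proj₁ (in-neighbour-of-peg p∈P Mbp≢0)))
    tip∉P (p∈P , _ , (w , eqw , Mpw≢0)) (inj₂ e) =
      subst (_∉ P) (trans eqw (sym e)) (proj₁ (proj₁ (out-neighbour-of-peg p∈P Mpw≢0)))

    routed-contained : ∀ {p o} → RoutedTromino M p o → All (_∈ R) (cellsOf R p o)
    routed-contained {p} {o} r = All.tabulate λ m → in-R (role {p} {o} r m)
      where
      in-R : ∀ {x} → Role p x → x ∈ R
      in-R (corner e)         = subst (_∈ R) (sym e) (∈-lookup p)
      in-R (entering {b} e _) = subst (_∈ R) (sym e) (∈-lookup b)
      in-R (leaving {w} e _)  = subst (_∈ R) (sym e) (∈-lookup w)

    disjoint : ∀ i o j o′ x → Selected R S i o → Selected R S j o′ →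
               x ∈ cellsOf R i o → x ∈ cellsOf R j o′ → i ≡ j × o ≡ o′
    disjoint i o j o′ x s s′ m m′ with selected-coverOf⁻ {M} {i} {o} s | selected-coverOf⁻ {M} {j} {o′} s′
    ... | r | r′ with role-determines-corner (proj₁ r) (proj₁ r′) (role {i} {o} r m) (role {j} {o′} r′ m′)
    ... | refl = refl , routed-unique r r′

    module _ (3|P|≡n : 3 * length P ≡ n) where
      open Saturation routing 3|P|≡n

      black-successor : ∀ {k} → InB R P k → ∃ λ p → InP R P p × M [ k , p ] ≢ 0
      black-successor {k} k∈B with ∑≢0⇒nonzero (λ j → M [ k , j ]) (≡1⇒≢0 (black-outdeg≡1 k∈B))
      ... | p , Mkp≢0 with along-edges k p Mkp≢0
      ...   | inj₁ (_ , p∈P , _) = p , p∈P , Mkp≢0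
      ...   | inj₂ (k∈P , _)     = ⊥-elim (proj₁ k∈B k∈P)

      white-predecessor : ∀ {k} → InW R P k → ∃ λ p → InP R P p × M [ p , k ] ≢ 0
      white-predecessor {k} k∈W with ∑≢0⇒nonzero (λ j → M [ j , k ]) (≡1⇒≢0 (white-indeg≡1 k∈W))
      ... | p , Mpk≢0 with along-edges p k Mpk≢0
      ...   | inj₂ (p∈P , _)     = p , p∈P , Mpk≢0
      ...   | inj₁ (_ , k∈P , _) = ⊥-elim (proj₁ k∈W k∈P)

      covers : ∀ x → x ∈ R → ∃₂ λ p o → Selected R S p o × x ∈ cellsOf R p o
      covers x x∈R = covered (classify k)
        where
        k : Fin n
        k = index x∈R
        x≡k : x ≡ cell k
        x≡k = lookup-index x∈R
        covered : Class k → ∃₂ λ p o → Selected R S p o × x ∈ cellsOf R p o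
        covered (peg k∈P) =
          let o , r = peg-routed k∈P in
          k , o , selected-coverOf⁺ r , here x≡k
        covered (black k∈B) =
          let p , p∈P , Mkp≢0 = black-successor k∈B
              o , r = peg-routed p∈P in
          p , o , selected-coverOf⁺ r ,
          subst (_∈ cellsOf R p o) (sym (trans x≡k (black-tip-routed {p} {o} r Mkp≢0))) (blackTip-∈ (cell p) o)
        covered (white k∈W) =
          let p , p∈P , Mpk≢0 = white-predecessor k∈W
              o , r = peg-routed p∈P in
          p , o , selected-coverOf⁺ r ,
          subst (_∈ cellsOf R p o) (sym (trans x≡k (white-tip-routed {p} {o} r Mpk≢0))) (whiteTip-∈ (cell p) o)

    coverOf-isPCover : 3 * length P ≡ n → IsPCover R P S
    coverOf-isPCover 3|P|≡n = record
      { contained  = λ i o s → routed-contained {i} {o} (selected-coverOf⁻ {M} {i} {o} s)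
      ; cornerInP  = λ i o s → proj₁ (selected-coverOf⁻ {M} {i} {o} s)
      ; tipHNotInP = λ i o s → tip∉P {i} {o} (selected-coverOf⁻ {M} {i} {o} s) (tipH-coloured (cell i) o)
      ; tipVNotInP = λ i o s → tip∉P {i} {o} (selected-coverOf⁻ {M} {i} {o} s) (tipV-coloured (cell i) o)
      ; disjoint   = disjoint
      ; covers     = covers 3|P|≡n
      }

    routingOf-coverOf : routingOf S ≡ M
    routingOf-coverOf = Vec-ext λ i → Vec-ext λ j →
      trans (routingOf-entry S i j) (entry i j (M [ i , j ] ≟ 0))
      where
      no-edge : ∀ {i j} → M [ i , j ] ≡ 0 → ¬ CoverEdge S i j
      no-edge {i} {j} Mij≡0 (inj₁ (o , s , eq)) with selected-coverOf⁻ {M} {j} {o} s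
      ... | _ , (b , eqb , Mbj≢0) , _ =
        Mbj≢0 (subst (λ k → M [ k , j ] ≡ 0) (cell-injective i b (trans eq (sym eqb))) Mij≡0)
      no-edge {i} {j} Mij≡0 (inj₂ (o , s , eq)) with selected-coverOf⁻ {M} {i} {o} s
      ... | _ , _ , (w , eqw , Miw≢0) =
        Miw≢0 (subst (λ k → M [ i , k ] ≡ 0) (cell-injective j w (trans eq (sym eqw))) Mij≡0)

      edge : ∀ {i j} → M [ i , j ] ≢ 0 → CoverEdge S i j
      edge {i} {j} Mij≢0 with along-edges i j Mij≢0
      ... | inj₁ (_ , j∈P , _) = let o , r = peg-routed j∈P in
                                 inj₁ (o , selected-coverOf⁺ r , black-tip-routed {j} {o} r Mij≢0)
      ... | inj₂ (i∈P , _)     = let o , r = peg-routed i∈P in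
                                 inj₂ (o , selected-coverOf⁺ r , white-tip-routed {i} {o} r Mij≢0)

      entry : ∀ i j → Dec (M [ i , j ] ≡ 0) → 𝟙 (CoverEdge? S i j) ≡ M [ i , j ]
      entry i j (yes Mij≡0) = trans (𝟙-no (CoverEdge? S i j) (no-edge Mij≡0)) (sym Mij≡0)
      entry i j (no  Mij≢0) = trans (𝟙-yes (CoverEdge? S i j) (edge Mij≢0))
                                    (sym (≤-antisym (entry≤1 i j) (n≢0⇒n>0 Mij≢0)))

  cover↔routing : 3 * length P ≡ n → Bijection (IsPCover R P) IsRouting
  cover↔routing 3|P|≡n = record
    { to      = routingOf
    ; from    = coverOf
    ; to-ok   = λ S cover → CoverToRouting.routingOf-isRouting cover
    ; from-ok = λ M routing → RoutingToCover.coverOf-isPCover routing 3|P|≡n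
    ; from-to = λ S cover → CoverToRouting.coverOf-routingOf cover
    ; to-from = λ M routing → RoutingToCover.routingOf-coverOf routing
    }

lemma3p5 : (R P : List Cell) → Unique R → Connected R →
           Unique P → All (_∈ R) P → 3 * length P ≡ length R →
           Bijection (IsPCover R P)
                     (λ (f : FlowData (length R)) → IsFlow R P f × value f ≡ length P)
lemma3p5 R P R-unique _ P-unique P⊆R 3|P|≡|R| =
  Bijection-trans (cover↔routing 3|P|≡|R|) routing↔flow
  where open RegionNetwork R P R-unique P-unique P⊆R
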